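{- Let $G$ and $H$ be finite graphs (each with at least one vertex). If $a(G)\le \frac12$ or $a(H)\le \frac12$, then \[ a(G\times H)\le \max\{a(G),a(H)\}. \]
   Context: All graphs are finite, simple and undirected. For a set $U\subseteq V(G)$, $N_G(U)$ denotes the neighborhood of $U$ in $G$, i.e. the set of vertices adjacent to some vertex of $U$. For a graph $G$ define \[ a(G)=\max\left\{\frac{|U|}{|U|+|N_G(U)|}\ :\ U \text{ a nonempty independent set of } G\right\}. \] The categorical (direct, tensor) product $G\times H$ has vertex set $V(G)\times V(H)$, and $\{(x_1,y_1),(x_2,y_2)\}$ is an edge iff $\{x_1,x_2\}\in E(G)$ and $\{y_1,y_2\}\in E(H)$. -}

module Defs where

open import Data.Nat using (ℕ; zero; suc; _+_; _*_)
open import Data.Bool using (Bool; true; false; _∧_; _∨_; not; if_then_else_)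
open import Data.Fin using (Fin; zero; suc; combine; remQuot)
open import Data.Fin.Subset using (Subset; ∣_∣)
open import Data.Vec using (Vec; []; _∷_; tabulate; lookup)
open import Data.List using (List; []; _∷_; map; _++_; foldr)
open import Data.Product using (_×_; _,_; proj₁; proj₂)
open import Data.Integer using (+_)
open import Data.Rational using (ℚ; _/_; _⊔_; 0ℚ)
open import Relation.Binary.PropositionalEquality using (_≡_; refl)

record Graph : Set where
  field
    n     : ℕ
    adj   : Fin n → Fin n → Bool
    sym   : ∀ x y → adj x y ≡ adj y x
    irrefl : ∀ x → adj x x ≡ false
open Graph public

anyFin : ∀ {k} → (Fin k → Bool) → Bool
anyFin {zero}  f = false
anyFin {suc k} f = f zero ∨ anyFin (λ i → f (suc i))

allFin : ∀ {k} → (Fin k → Bool) → Bool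
allFin {zero}  f = true
allFin {suc k} f = f zero ∧ allFin (λ i → f (suc i))

nbhd : (G : Graph) → Subset (n G) → Subset (n G)
nbhd G U = tabulate λ v → anyFin λ u → lookup U u ∧ adj G u v

independent : (G : Graph) → Subset (n G) → Bool
independent G U = allFin λ u → allFin λ v → not (lookup U u ∧ lookup U v ∧ adj G u v)

nonempty : ∀ {k} → Subset k → Bool
nonempty U = anyFin λ u → lookup U u

allSubsets : (k : ℕ) → List (Subset k)
allSubsets zero    = [] ∷ []
allSubsets (suc k) = map (true ∷_) (allSubsets k) ++ map (false ∷_) (allSubsets k)

-- |U| / (|U| + |N(U)|) as a rational; the denominator is 1 + ... when U is empty
-- only to keep the division total (empty U never contributes to a(G)).
ratio : (G : Graph) → Subset (n G) → ℚ
ratio G U with ∣ U ∣ + ∣ nbhd G U ∣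
... | zero  = 0ℚ
... | suc d = + ∣ U ∣ / suc d

-- a(G) = max over nonempty independent U of |U| / (|U| + |N_G(U)|).
-- (Folding from 0 is harmless: all contributing ratios are positive, and for
-- graphs with at least one vertex a singleton is a nonempty independent set.)
a : Graph → ℚ
a G = foldr (λ U acc → if nonempty U ∧ independent G U then ratio G U ⊔ acc else acc)
            0ℚ (allSubsets (n G))

-- Categorical (tensor) product, vertex set Fin (n G * n H) ≅ Fin (n G) × Fin (n H)
-- via combine / remQuot.
prodAdj : (G H : Graph) → Fin (n G * n H) → Fin (n G * n H) → Bool
prodAdj G H p q =
  adj G (proj₁ (remQuot {n G} (n H) p)) (proj₁ (remQuot {n G} (n H) q))
  ∧ adj H (proj₂ (remQuot {n G} (n H) p)) (proj₂ (remQuot {n G} (n H) q))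

prodAdj-sym : (G H : Graph) → ∀ p q → prodAdj G H p q ≡ prodAdj G H q p
prodAdj-sym G H p q
  rewrite sym G (proj₁ (remQuot {n G} (n H) p)) (proj₁ (remQuot {n G} (n H) q))
        | sym H (proj₂ (remQuot {n G} (n H) p)) (proj₂ (remQuot {n G} (n H) q)) = refl

prodAdj-irrefl : (G H : Graph) → ∀ p → prodAdj G H p p ≡ false
prodAdj-irrefl G H p rewrite irrefl G (proj₁ (remQuot {n G} (n H) p)) = refl

_×ᴳ_ : Graph → Graph → Graph
G ×ᴳ H = record
  { n = n G * n H
  ; adj = prodAdj G H
  ; sym = prodAdj-sym G H
  ; irrefl = prodAdj-irrefl G H
  }

-- Let r = max(a G, a H) = P/Q and, say, a G ≤ ½; let I be independent in G × H, with rows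
-- R x ⊆ V(H).  Each row splits into its isolated part R° x (no neighbour inside R x, hence
-- independent in H) and its attached part R• x ⊆ N_H(R x); the same is done with the columns
-- C y = {x | y ∈ N_H(R x)} of the row neighbourhoods, and N(I) = ⋃_y N_G(C y) × {y}.
-- Since N_H(R° x) and R• x are disjoint inside N_H(R x), and likewise for the columns,
--   |N_H(R° x)| + |R• x| ≤ |N_H(R x)|   and   |N_G(C° y)| + |C• y| ≤ |N_G(C y)|,
-- while independence of I puts x into C° y whenever y ∈ R• x.  Bounding the R° x with
-- a H ≤ r and the C° y with both a G ≤ r and a G ≤ ½, and adding up, gives
-- |I| ≤ r (|I| + |N(I)|).
module Submission where

open import Defs renaming (sym to adj-sym)

module Arithmetic where
  open import Data.List using ([]; _∷_)
  open import Data.Nat using (_+_; _*_; _≤_)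
  open import Data.Nat.Properties
  open import Data.Nat.Tactic.RingSolver using (solve)
  open import Data.Product using (_,_)
  open import Data.Sum using (inj₁; inj₂)
  open import Relation.Binary.PropositionalEquality using (refl)

  mediant-≤ : ∀ P Q c m c′ m′ → c * Q ≤ P * (c + m) → c′ * Q ≤ P * (c′ + m′) →
    (c + c′) * Q ≤ P * (c + c′ + (m + m′))
  mediant-≤ P Q c m c′ m′ cQ≤P[c+m] c′Q≤P[c′+m′] = begin
    (c + c′) * Q                ≡⟨ *-distribʳ-+ Q c c′ ⟩
    c * Q + c′ * Q              ≤⟨ +-mono-≤ cQ≤P[c+m] c′Q≤P[c′+m′] ⟩
    P * (c + m) + P * (c′ + m′) ≡⟨ solve (P ∷ c ∷ m ∷ c′ ∷ m′ ∷ []) ⟩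
    P * (c + c′ + (m + m′))     ∎
    where open ≤-Reasoning

  *2≤1*[+]⇒≤ : ∀ {c m} → c * 2 ≤ 1 * (c + m) → c ≤ m
  *2≤1*[+]⇒≤ {c} {m} c2≤c+m = +-cancelˡ-≤ c c m (begin
    c + c        ≡⟨ solve (c ∷ []) ⟩
    c * 2        ≤⟨ c2≤c+m ⟩
    1 * (c + m)  ≡⟨ *-identityˡ (c + m) ⟩
    c + m        ∎)
    where open ≤-Reasoning

  -- With r = P/Q: for r ≥ ½ use b ≤ 2rb and d ≤ g; for r < ½, (1 − r) d ≤ r g and b ≤ d give
  -- b + r d ≤ (1 − 2r) d + 2r b + r d ≤ 2r b + r g.
  b*Q+P*d≤P*[b+b+g] : ∀ P Q b d g → d ≤ g → d * Q ≤ P * (d + g) → b ≤ d →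
    b * Q + P * d ≤ P * (b + b + g)
  b*Q+P*d≤P*[b+b+g] P Q b d g d≤g dQ≤P[d+g] b≤d with ≤-total Q (P + P) | m≤n⇒∃[o]m+o≡n b≤d
  ... | inj₁ Q≤2P | _ = begin
    b * Q + P * d        ≤⟨ +-mono-≤ (*-monoʳ-≤ b Q≤2P) (*-monoʳ-≤ P d≤g) ⟩
    b * (P + P) + P * g  ≡⟨ solve (P ∷ b ∷ g ∷ []) ⟩
    P * (b + b + g)      ∎
    where open ≤-Reasoning
  ... | inj₂ 2P≤Q | t , refl = +-cancelʳ-≤ (t * (P + P)) _ _ (begin
    b * Q + P * (b + t) + t * (P + P)  ≤⟨ +-monoʳ-≤ _ (*-monoʳ-≤ t 2P≤Q) ⟩
    b * Q + P * (b + t) + t * Q        ≡⟨ solve (P ∷ Q ∷ b ∷ t ∷ []) ⟩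
    (b + t) * Q + P * (b + t)          ≤⟨ +-monoˡ-≤ _ dQ≤P[d+g] ⟩
    P * (b + t + g) + P * (b + t)      ≡⟨ solve (P ∷ b ∷ t ∷ g ∷ []) ⟩
    P * (b + b + g) + t * (P + P)      ∎)
    where open ≤-Reasoning

  [c+b]*Q≤P*[c+b+m] : ∀ P Q c b h d e g m →
    c * Q ≤ P * (c + h) → h + b ≤ d + e → g + e ≤ m →
    d ≤ g → d * Q ≤ P * (d + g) → b ≤ d →
    (c + b) * Q ≤ P * (c + b + m)
  [c+b]*Q≤P*[c+b+m] P Q c b h d e g m cQ≤P[c+h] h+b≤d+e g+e≤m d≤g dQ≤P[d+g] b≤d =
    +-cancelʳ-≤ (P * d) _ _ (begin
      (c + b) * Q + P * d            ≡⟨ solve (P ∷ Q ∷ c ∷ b ∷ d ∷ []) ⟩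
      c * Q + (b * Q + P * d)        ≤⟨ +-mono-≤ cQ≤P[c+h] (b*Q+P*d≤P*[b+b+g] P Q b d g d≤g dQ≤P[d+g] b≤d) ⟩
      P * (c + h) + P * (b + b + g)  ≡⟨ solve (P ∷ c ∷ h ∷ b ∷ g ∷ []) ⟩
      P * (c + b + (h + b) + g)      ≤⟨ *-monoʳ-≤ P (+-monoˡ-≤ g (+-monoʳ-≤ (c + b) h+b≤d+e)) ⟩
      P * (c + b + (d + e) + g)      ≡⟨ solve (P ∷ c ∷ b ∷ d ∷ e ∷ g ∷ []) ⟩
      P * (c + b + (g + e)) + P * d  ≤⟨ +-monoˡ-≤ (P * d) (*-monoʳ-≤ P (+-monoʳ-≤ (c + b) g+e≤m)) ⟩
      P * (c + b + m) + P * d        ∎)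
    where open ≤-Reasoning

module Counting where
  open import Data.Bool using (Bool; true; false; _∧_; not)
  open import Data.Bool.Properties using (∧-conicalˡ; ∧-conicalʳ; ∧-comm; not-injective; not-¬; ⇔→≡)
  open import Data.Empty using (⊥; ⊥-elim)
  open import Data.Fin using (Fin; zero; suc; combine; remQuot; _↑ˡ_; _↑ʳ_)
  open import Data.Fin.Properties using (remQuot-combine; combine-remQuot)
  open import Data.Fin.Subset using (Subset; ∣_∣)
  open import Data.Nat using (ℕ; zero; suc; _+_; _*_; _≤_; z≤n; s≤s)
  open import Data.Nat.Properties as ℕP using (+-mono-≤; +-assoc; ≤-trans; ≤-reflexive; module ≤-Reasoning)
  open import Data.Product using (_×_; _,_; proj₁; proj₂; ∃; ∃₂)
  open import Data.Vec using ([]; _∷_; tabulate; lookup)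
  open import Data.Vec.Properties using (lookup∘tabulate)
  open import Function using (_∘_; flip; _⇔_; mk⇔; Equivalence)
  open import Relation.Binary.PropositionalEquality
    using (_≡_; refl; sym; trans; cong; cong₂; subst; subst₂; module ≡-Reasoning)
  open import Algebra.Properties.CommutativeMonoid.Sum ℕP.+-0-commutativeMonoid
    using (sum; sum-syntax; sum-cong-≗; ∑-distrib-+; ∑-comm)
  open Arithmetic

  sum-mono-≤ : ∀ {k} {f g : Fin k → ℕ} → (∀ i → f i ≤ g i) → sum f ≤ sum g
  sum-mono-≤ {zero}  f≤g = z≤n
  sum-mono-≤ {suc k} f≤g = +-mono-≤ (f≤g zero) (sum-mono-≤ (f≤g ∘ suc))

  sum-+-≤ : ∀ {k} {f g h : Fin k → ℕ} → (∀ i → f i + g i ≤ h i) → sum f + sum g ≤ sum h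
  sum-+-≤ {f = f} {g} f+g≤h = ≤-trans (≤-reflexive (sym (∑-distrib-+ f g))) (sum-mono-≤ f+g≤h)

  sum-↑ : ∀ k l (f : Fin (k + l) → ℕ) → sum f ≡ ∑[ i < k ] f (i ↑ˡ l) + ∑[ j < l ] f (k ↑ʳ j)
  sum-↑ zero    l f = refl
  sum-↑ (suc k) l f = trans (cong (f zero +_) (sum-↑ k l (f ∘ suc))) (sym (+-assoc (f zero) _ _))

  sum-combine : ∀ k l (f : Fin (k * l) → ℕ) → sum f ≡ ∑[ i < k ] ∑[ j < l ] f (combine i j)
  sum-combine zero    l f = refl
  sum-combine (suc k) l f =
    trans (sum-↑ l (k * l) f) (cong (∑[ j < l ] f (j ↑ˡ k * l) +_) (sum-combine k l (f ∘ (l ↑ʳ_))))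

  ∧-intro : ∀ {x y} → x ≡ true → y ≡ true → x ∧ y ≡ true
  ∧-intro refl refl = refl

  not-∧∧≡true⇔ : ∀ x y z → not (x ∧ y ∧ z) ≡ true ⇔ (x ≡ true → y ≡ true → z ≡ false)
  not-∧∧≡true⇔ true  true  z =
    mk⇔ (λ nz≡true _ _ → not-injective nz≡true) (λ z≡false → cong not (z≡false refl refl))
  not-∧∧≡true⇔ true  false z = mk⇔ (λ _ _ ()) (λ _ → refl)
  not-∧∧≡true⇔ false y     z = mk⇔ (λ _ ()) (λ _ → refl)

  anyFin⇒∃ : ∀ {k} (p : Fin k → Bool) → anyFin p ≡ true → ∃ λ i → p i ≡ true
  anyFin⇒∃ {suc k} p any with p zero in p0≡true
  ... | true  = zero , p0≡true
  ... | false = let i , pi≡true = anyFin⇒∃ (p ∘ suc) any in suc i , pi≡true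

  ∃⇒anyFin : ∀ {k} (p : Fin k → Bool) i → p i ≡ true → anyFin p ≡ true
  ∃⇒anyFin p zero    pi≡true rewrite pi≡true = refl
  ∃⇒anyFin p (suc i) pi≡true with p zero
  ... | true  = refl
  ... | false = ∃⇒anyFin (p ∘ suc) i pi≡true

  allFin⇒∀ : ∀ {k} (p : Fin k → Bool) → allFin p ≡ true → ∀ i → p i ≡ true
  allFin⇒∀ p all zero    = ∧-conicalˡ (p zero) _ all
  allFin⇒∀ p all (suc i) = allFin⇒∀ (p ∘ suc) (∧-conicalʳ (p zero) _ all) i

  ∀⇒allFin : ∀ {k} (p : Fin k → Bool) → (∀ i → p i ≡ true) → allFin p ≡ true
  ∀⇒allFin {zero}  p ∀p = refl
  ∀⇒allFin {suc k} p ∀p = ∧-intro (∀p zero) (∀⇒allFin (p ∘ suc) (∀p ∘ suc))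

  𝟙 : Bool → ℕ
  𝟙 true  = 1
  𝟙 false = 0

  count : ∀ {k} → (Fin k → Bool) → ℕ
  count {k} p = ∑[ i < k ] 𝟙 (p i)

  _⊆_ : ∀ {k} → (Fin k → Bool) → (Fin k → Bool) → Set
  p ⊆ q = ∀ i → p i ≡ true → q i ≡ true

  Disjoint : ∀ {k} → (Fin k → Bool) → (Fin k → Bool) → Set
  Disjoint p q = ∀ i → p i ≡ true → q i ≡ true → ⊥

  count-cong : ∀ {k} {p q : Fin k → Bool} → (∀ i → p i ≡ q i) → count p ≡ count q
  count-cong p≗q = sum-cong-≗ (cong 𝟙 ∘ p≗q)

  count-mono : ∀ {k} {p q : Fin k → Bool} → p ⊆ q → count p ≤ count q
  count-mono {p = p} {q} p⊆q = sum-mono-≤ λ i → 𝟙-mono (p i) (q i) (p⊆q i)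
    where
    𝟙-mono : ∀ x y → (x ≡ true → y ≡ true) → 𝟙 x ≤ 𝟙 y
    𝟙-mono true  y x⇒y rewrite x⇒y refl = s≤s z≤n
    𝟙-mono false y x⇒y = z≤n

  count-disjoint-≤ : ∀ {k} {p q s : Fin k → Bool} →
    p ⊆ s → q ⊆ s → Disjoint p q → count p + count q ≤ count s
  count-disjoint-≤ {p = p} {q} {s} p⊆s q⊆s p#q =
    sum-+-≤ λ i → 𝟙-disjoint (p i) (q i) (s i) (p⊆s i) (q⊆s i) (p#q i)
    where
    𝟙-disjoint : ∀ x y z → (x ≡ true → z ≡ true) → (y ≡ true → z ≡ true) →
      (x ≡ true → y ≡ true → ⊥) → 𝟙 x + 𝟙 y ≤ 𝟙 z
    𝟙-disjoint true  true  z x⇒z y⇒z x#y = ⊥-elim (x#y refl refl)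
    𝟙-disjoint true  false z x⇒z y⇒z x#y rewrite x⇒z refl = s≤s z≤n
    𝟙-disjoint false true  z x⇒z y⇒z x#y rewrite y⇒z refl = s≤s z≤n
    𝟙-disjoint false false z x⇒z y⇒z x#y = z≤n

  count-split : ∀ {k} (p q : Fin k → Bool) →
    count p ≡ count (λ i → p i ∧ not (q i)) + count (λ i → p i ∧ q i)
  count-split p q = trans (sum-cong-≗ λ i → 𝟙-split (p i) (q i))
    (∑-distrib-+ (λ i → 𝟙 (p i ∧ not (q i))) (λ i → 𝟙 (p i ∧ q i)))
    where
    𝟙-split : ∀ x y → 𝟙 x ≡ 𝟙 (x ∧ not y) + 𝟙 (x ∧ y)
    𝟙-split true  true  = refl
    𝟙-split true  false = refl
    𝟙-split false y     = refl

  anyFin≡false⇒count≡0 : ∀ {k} (p : Fin k → Bool) → anyFin p ≡ false → count p ≡ 0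
  anyFin≡false⇒count≡0 {zero}  p none = refl
  anyFin≡false⇒count≡0 {suc k} p none with p zero
  ... | false = anyFin≡false⇒count≡0 (p ∘ suc) none

  ∣∣≡count-lookup : ∀ {k} (U : Subset k) → ∣ U ∣ ≡ count (lookup U)
  ∣∣≡count-lookup []          = refl
  ∣∣≡count-lookup (true ∷ U)  = cong suc (∣∣≡count-lookup U)
  ∣∣≡count-lookup (false ∷ U) = ∣∣≡count-lookup U

  ∣tabulate∣ : ∀ {k} (p : Fin k → Bool) → ∣ tabulate p ∣ ≡ count p
  ∣tabulate∣ p = trans (∣∣≡count-lookup (tabulate p)) (count-cong (lookup∘tabulate p))

  module _ (K : Graph) where

    N : (Fin (n K) → Bool) → Fin (n K) → Bool
    N p v = anyFin λ u → p u ∧ adj K u v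

    Independent : (Fin (n K) → Bool) → Set
    Independent p = ∀ u v → p u ≡ true → p v ≡ true → adj K u v ≡ false

    isolated : (Fin (n K) → Bool) → Fin (n K) → Bool
    isolated p u = p u ∧ not (N p u)

    attached : (Fin (n K) → Bool) → Fin (n K) → Bool
    attached p u = p u ∧ N p u

    N⇒∃ : ∀ p v → N p v ≡ true → ∃ λ u → p u ≡ true × adj K u v ≡ true
    N⇒∃ p v v∈Np with anyFin⇒∃ _ v∈Np
    ... | u , pu∧uv = u , ∧-conicalˡ (p u) _ pu∧uv , ∧-conicalʳ (p u) _ pu∧uv

    ∃⇒N : ∀ p u v → p u ≡ true → adj K u v ≡ true → N p v ≡ true
    ∃⇒N p u v pu uv = ∃⇒anyFin (λ w → p w ∧ adj K w v) u (∧-intro pu uv)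

    N-mono : ∀ {p q} → p ⊆ q → N p ⊆ N q
    N-mono {p} {q} p⊆q v v∈Np with N⇒∃ p v v∈Np
    ... | u , pu , uv = ∃⇒N q u v (p⊆q u pu) uv

    N-cong : ∀ {p q} → (∀ u → p u ≡ q u) → ∀ v → N p v ≡ N q v
    N-cong p≗q v = ⇔→≡ {z = true}
      (mk⇔ (N-mono (λ u → trans (sym (p≗q u))) v) (N-mono (λ u → trans (p≗q u)) v))

    ∣nbhd-tabulate∣ : ∀ p → ∣ nbhd K (tabulate p) ∣ ≡ count (N p)
    ∣nbhd-tabulate∣ p = trans (∣tabulate∣ (N (lookup (tabulate p)))) (count-cong (N-cong (lookup∘tabulate p)))

    Independent-⊆ : ∀ {p q} → p ⊆ q → Independent q → Independent p
    Independent-⊆ p⊆q q-indep u v pu pv = q-indep u v (p⊆q u pu) (p⊆q v pv)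

    independent⇔Independent : ∀ U → independent K U ≡ true ⇔ Independent (lookup U)
    independent⇔Independent U = mk⇔
      (λ indep u v → to (not-∧∧≡true⇔ _ _ _) (allFin⇒∀ _ (allFin⇒∀ _ indep u) v))
      (λ indep → ∀⇒allFin _ λ u → ∀⇒allFin _ λ v → from (not-∧∧≡true⇔ _ _ _) (indep u v))
      where open Equivalence

    isolated⊆ : ∀ p → isolated p ⊆ p
    isolated⊆ p u = ∧-conicalˡ (p u) _

    isolated⇒∉N : ∀ p v → isolated p v ≡ true → N p v ≡ false
    isolated⇒∉N p v v-isolated = not-injective (∧-conicalʳ (p v) _ v-isolated)

    isolated-independent : ∀ p → Independent (isolated p)
    isolated-independent p u v u-isolated v-isolated with adj K u v in uv
    ... | false = refl
    ... | true  = ⊥-elim (not-¬ (∃⇒N p u v (isolated⊆ p u u-isolated) uv) (isolated⇒∉N p v v-isolated))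

    count-isolated+attached : ∀ p → count p ≡ count (isolated p) + count (attached p)
    count-isolated+attached p = count-split p (N p)

    count-N-isolated+attached≤count-N : ∀ p → count (N (isolated p)) + count (attached p) ≤ count (N p)
    count-N-isolated+attached≤count-N p =
      count-disjoint-≤ (N-mono (isolated⊆ p)) (λ v → ∧-conicalʳ (p v) _) N-isolated#attached
      where
      N-isolated#attached : Disjoint (N (isolated p)) (attached p)
      N-isolated#attached v v∈N with N⇒∃ (isolated p) v v∈N
      ... | u , u-isolated , uv = λ v-attached →
        not-¬ (∃⇒N p v u (∧-conicalˡ (p v) _ v-attached) (trans (adj-sym K v u) uv)) (isolated⇒∉N p u u-isolated)

  RatioBounded : ℕ → ℕ → Graph → Set
  RatioBounded P Q K = ∀ p → Independent K p → count p * Q ≤ P * (count p + count (N K p))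

  ratioBounded-∑ : ∀ P Q K {k} → RatioBounded P Q K → (ps : Fin k → Fin (n K) → Bool) →
    (∀ i → Independent K (ps i)) →
    (∑[ i < k ] count (ps i)) * Q ≤ P * (∑[ i < k ] count (ps i) + ∑[ i < k ] count (N K (ps i)))
  ratioBounded-∑ P Q K {zero}  K-bounded ps ps-indep = z≤n
  ratioBounded-∑ P Q K {suc k} K-bounded ps ps-indep =
    mediant-≤ P Q (count (ps zero)) (count (N K (ps zero)))
      (∑[ i < k ] count (ps (suc i))) (∑[ i < k ] count (N K (ps (suc i))))
      (K-bounded (ps zero) (ps-indep zero)) (ratioBounded-∑ P Q K K-bounded (ps ∘ suc) (ps-indep ∘ suc))

  ratioBounded-½ : ∀ K → RatioBounded 1 2 K → ∀ p → Independent K p → count p ≤ count (N K p)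
  ratioBounded-½ K K-bounded p p-indep = *2≤1*[+]⇒≤ (K-bounded p p-indep)

  -- An independent set of G × H is handled as a relation R between V(G) and V(H).
  module _ (G H : Graph) where

    ProductIndependent : (Fin (n G) → Fin (n H) → Bool) → Set
    ProductIndependent R =
      ∀ x x′ y y′ → R x y ≡ true → R x′ y′ ≡ true → adj G x x′ ∧ adj H y y′ ≡ false

    rowNbhdColumn : (Fin (n G) → Fin (n H) → Bool) → Fin (n H) → Fin (n G) → Bool
    rowNbhdColumn R y x = N H (R x) y

    productN : (Fin (n G) → Fin (n H) → Bool) → Fin (n G) → Fin (n H) → Bool
    productN R x′ y′ = N G (rowNbhdColumn R y′) x′

    ProductAdjacent : (Fin (n G) → Fin (n H) → Bool) → Fin (n G) → Fin (n H) → Set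
    ProductAdjacent R x′ y′ = ∃₂ λ x y → R x y ≡ true × adj G x x′ ≡ true × adj H y y′ ≡ true

    productN⇒adjacent : ∀ R x′ y′ → productN R x′ y′ ≡ true → ProductAdjacent R x′ y′
    productN⇒adjacent R x′ y′ x′∈N with N⇒∃ G _ x′ x′∈N
    ... | x , y′∈NRx , xx′ with N⇒∃ H (R x) y′ y′∈NRx
    ...   | y , Rxy , yy′ = x , y , Rxy , xx′ , yy′

    adjacent⇒productN : ∀ R x′ y′ → ProductAdjacent R x′ y′ → productN R x′ y′ ≡ true
    adjacent⇒productN R x′ y′ (x , y , Rxy , xx′ , yy′) = ∃⇒N G _ x x′ (∃⇒N H (R x) y y′ Rxy yy′) xx′

    attached-row⊆isolated-column : ∀ R → ProductIndependent R →
      ∀ x y → attached H (R x) y ≡ true → isolated G (rowNbhdColumn R y) x ≡ true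
    attached-row⊆isolated-column R R-indep x y y-attached =
      ∧-intro (∧-conicalʳ (R x y) _ y-attached) (cong not x∉N-column)
      where
      x∉N-column : N G (rowNbhdColumn R y) x ≡ false
      x∉N-column with N G (rowNbhdColumn R y) x in x∈N-column
      ... | false = refl
      ... | true with productN⇒adjacent R x y x∈N-column
      ...   | x₀ , y₀ , Rx₀y₀ , x₀x , y₀y =
        ⊥-elim (not-¬ (∧-intro x₀x y₀y) (R-indep x₀ x y₀ y Rx₀y₀ (∧-conicalˡ (R x y) _ y-attached)))

    ProductBound : ℕ → ℕ → (Fin (n G) → Fin (n H) → Bool) → Set
    ProductBound P Q R =
      (∑[ x < n G ] count (R x)) * Q ≤ P * (∑[ x < n G ] count (R x) + ∑[ x < n G ] count (productN R x))

  productBound : ∀ P Q G H → RatioBounded 1 2 G → RatioBounded P Q G → RatioBounded P Q H →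
    ∀ R → ProductIndependent G H R → ProductBound G H P Q R
  productBound P Q G H G-½ G-bounded H-bounded R R-indep =
    subst (λ t → t * Q ≤ P * (t + m)) (sym rows≡c+b)
      ([c+b]*Q≤P*[c+b+m] P Q c b h d e g m c-bound h+b≤d+e g+e≤m d≤g d-bound b≤d)
    where
    column : Fin (n H) → Fin (n G) → Bool
    column = rowNbhdColumn G H R

    c b h d e g m : ℕ
    c = ∑[ x < n G ] count (isolated H (R x))
    b = ∑[ x < n G ] count (attached H (R x))
    h = ∑[ x < n G ] count (N H (isolated H (R x)))
    d = ∑[ y < n H ] count (isolated G (column y))
    e = ∑[ y < n H ] count (attached G (column y))
    g = ∑[ y < n H ] count (N G (isolated G (column y)))
    m = ∑[ x < n G ] count (productN G H R x)

    rows≡c+b : ∑[ x < n G ] count (R x) ≡ c + b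
    rows≡c+b = trans (sum-cong-≗ (count-isolated+attached H ∘ R))
      (∑-distrib-+ (λ x → count (isolated H (R x))) (λ x → count (attached H (R x))))

    c-bound : c * Q ≤ P * (c + h)
    c-bound = ratioBounded-∑ P Q H H-bounded (isolated H ∘ R) (isolated-independent H ∘ R)

    h+b≤d+e : h + b ≤ d + e
    h+b≤d+e = begin
      h + b                           ≤⟨ sum-+-≤ (count-N-isolated+attached≤count-N H ∘ R) ⟩
      ∑[ x < n G ] count (N H (R x))  ≡⟨ ∑-comm (λ x y → 𝟙 (column y x)) ⟩
      ∑[ y < n H ] count (column y)   ≡⟨ sum-cong-≗ (count-isolated+attached G ∘ column) ⟩
      ∑[ y < n H ] (count (isolated G (column y)) + count (attached G (column y)))
        ≡⟨ ∑-distrib-+ (λ y → count (isolated G (column y))) (λ y → count (attached G (column y))) ⟩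
      d + e                           ∎
      where open ≤-Reasoning

    g+e≤m : g + e ≤ m
    g+e≤m = ≤-trans (sum-+-≤ (count-N-isolated+attached≤count-N G ∘ column))
                    (≤-reflexive (∑-comm (λ y x → 𝟙 (productN G H R x y))))

    d≤g : d ≤ g
    d≤g = sum-mono-≤ λ y → ratioBounded-½ G G-½ (isolated G (column y)) (isolated-independent G (column y))

    d-bound : d * Q ≤ P * (d + g)
    d-bound = ratioBounded-∑ P Q G G-bounded (isolated G ∘ column) (isolated-independent G ∘ column)

    b≤d : b ≤ d
    b≤d = ≤-trans (≤-reflexive (∑-comm (λ x y → 𝟙 (attached H (R x) y))))
                  (sum-mono-≤ λ y → count-mono (λ x → attached-row⊆isolated-column G H R R-indep x y))

  adjacent-swap : ∀ G H R x y → ProductAdjacent G H R x y → ProductAdjacent H G (flip R) y x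
  adjacent-swap G H R x y (x₀ , y₀ , Rx₀y₀ , x₀x , y₀y) = y₀ , x₀ , Rx₀y₀ , y₀y , x₀x

  productN-swap : ∀ G H R x y → productN H G (flip R) y x ≡ productN G H R x y
  productN-swap G H R x y = ⇔→≡ {z = true} (mk⇔
    (adjacent⇒productN G H R x y ∘ adjacent-swap H G (flip R) y x ∘ productN⇒adjacent H G (flip R) y x)
    (adjacent⇒productN H G (flip R) y x ∘ adjacent-swap G H R x y ∘ productN⇒adjacent G H R x y))

  productIndependent-swap : ∀ G H R → ProductIndependent G H R → ProductIndependent H G (flip R)
  productIndependent-swap G H R R-indep y y′ x x′ Rxy Rx′y′ =
    trans (∧-comm (adj H y y′) (adj G x x′)) (R-indep x x′ y y′ Rxy Rx′y′)

  productBound-swap : ∀ P Q G H R → ProductBound H G P Q (flip R) → ProductBound G H P Q R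
  productBound-swap P Q G H R =
    subst₂ (λ s t → s * Q ≤ P * (s + t)) (∑-comm (λ y x → 𝟙 (R x y))) (begin
      ∑[ y < n H ] count (productN H G (flip R) y)
        ≡⟨ sum-cong-≗ (λ y → count-cong (λ x → productN-swap G H R x y)) ⟩
      ∑[ y < n H ] ∑[ x < n G ] 𝟙 (productN G H R x y)
        ≡⟨ ∑-comm (λ y x → 𝟙 (productN G H R x y)) ⟩
      ∑[ x < n G ] count (productN G H R x)
        ∎)
    where open ≡-Reasoning

  module _ (G H : Graph) where

    toRelation : Subset (n G * n H) → Fin (n G) → Fin (n H) → Bool
    toRelation I x y = lookup I (combine x y)

    prodAdj-combine : ∀ x y x′ y′ → prodAdj G H (combine x y) (combine x′ y′) ≡ adj G x x′ ∧ adj H y y′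
    prodAdj-combine x y x′ y′ = cong₂ (λ u v → adj G (proj₁ u) (proj₁ v) ∧ adj H (proj₂ u) (proj₂ v))
      (remQuot-combine {n G} {n H} x y) (remQuot-combine {n G} {n H} x′ y′)

    N-×ᴳ-combine : ∀ I x′ y′ → N (G ×ᴳ H) (lookup I) (combine x′ y′) ≡ productN G H (toRelation I) x′ y′
    N-×ᴳ-combine I x′ y′ = ⇔→≡ {z = true} (mk⇔ to (from ∘ productN⇒adjacent G H (toRelation I) x′ y′))
      where
      to : N (G ×ᴳ H) (lookup I) (combine x′ y′) ≡ true → productN G H (toRelation I) x′ y′ ≡ true
      to xy′∈N with N⇒∃ (G ×ᴳ H) (lookup I) _ xy′∈N
      ... | p , Ip , p~xy′ = adjacent⇒productN G H (toRelation I) x′ y′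
        (x , y , trans (cong (lookup I) xy≡p) Ip ,
         ∧-conicalˡ (adj G x x′) _ xy~xy′ , ∧-conicalʳ (adj G x x′) _ xy~xy′)
        where
        x : Fin (n G)
        x = proj₁ (remQuot {n G} (n H) p)
        y : Fin (n H)
        y = proj₂ (remQuot {n G} (n H) p)
        xy≡p : combine x y ≡ p
        xy≡p = combine-remQuot {n G} (n H) p
        xy~xy′ : adj G x x′ ∧ adj H y y′ ≡ true
        xy~xy′ = trans (sym (prodAdj-combine x y x′ y′))
                       (trans (cong (λ q → prodAdj G H q (combine x′ y′)) xy≡p) p~xy′)
      from : ProductAdjacent G H (toRelation I) x′ y′ → N (G ×ᴳ H) (lookup I) (combine x′ y′) ≡ true
      from (x , y , Rxy , xx′ , yy′) =
        ∃⇒N (G ×ᴳ H) (lookup I) (combine x y) (combine x′ y′) Rxy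
            (trans (prodAdj-combine x y x′ y′) (∧-intro xx′ yy′))

    ∣∣≡∑-count-toRelation : ∀ I → ∣ I ∣ ≡ ∑[ x < n G ] count (toRelation I x)
    ∣∣≡∑-count-toRelation I = trans (∣∣≡count-lookup I) (sum-combine (n G) (n H) (𝟙 ∘ lookup I))

    ∣nbhd-×ᴳ∣≡∑-count-productN : ∀ I →
      ∣ nbhd (G ×ᴳ H) I ∣ ≡ ∑[ x < n G ] count (productN G H (toRelation I) x)
    ∣nbhd-×ᴳ∣≡∑-count-productN I = begin
      ∣ nbhd (G ×ᴳ H) I ∣
        ≡⟨ ∣tabulate∣ (N (G ×ᴳ H) (lookup I)) ⟩
      count (N (G ×ᴳ H) (lookup I))
        ≡⟨ sum-combine (n G) (n H) _ ⟩
      ∑[ x < n G ] ∑[ y < n H ] 𝟙 (N (G ×ᴳ H) (lookup I) (combine x y))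
        ≡⟨ sum-cong-≗ (λ x → count-cong (N-×ᴳ-combine I x)) ⟩
      ∑[ x < n G ] count (productN G H (toRelation I) x)
        ∎
      where open ≡-Reasoning

    independent⇒productIndependent : ∀ I → independent (G ×ᴳ H) I ≡ true → ProductIndependent G H (toRelation I)
    independent⇒productIndependent I I-indep x x′ y y′ Rxy Rx′y′ =
      trans (sym (prodAdj-combine x y x′ y′))
            (Equivalence.to (independent⇔Independent (G ×ᴳ H) I) I-indep (combine x y) (combine x′ y′) Rxy Rx′y′)

open Arithmetic
open Counting
open import Data.Bool using (true; false; _∧_; if_then_else_)
open import Data.Bool.Properties using (∧-conicalʳ)
open import Data.Fin.Subset using (Subset; ∣_∣)
open import Data.Integer as ℤ using (+_; +≤+)
import Data.Integer.Properties as ℤP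
open import Data.List using (map; foldr; []; _∷_)
open import Data.List.Membership.Propositional using (_∈_)
open import Data.List.Membership.Propositional.Properties using (∈-++⁺ˡ; ∈-++⁺ʳ; ∈-map⁺)
open import Data.List.Relation.Unary.Any using (here; there)
open import Data.Nat as ℕ using (ℕ; zero; suc; _≥_)
open import Data.Nat.Properties using (m+n≡0⇒m≡0)
open import Data.Rational using (ℚ; _/_; _≤_; ↥_; ↧_; ↧ₙ_; 0ℚ; _⊔_; ½; toℚᵘ)
open import Data.Rational.Properties
  using (≤-refl; ≤-trans; nonNegative⁻¹; p≤p⊔q; p≤q⊔p; ⊔-lub;
         toℚᵘ-fromℚᵘ; toℚᵘ-mono-≤; toℚᵘ-cancel-≤; drop-*≤*)
open import Data.Rational.Unnormalised using (mkℚᵘ; *≤*) renaming (_≃_ to _≃ᵘ_)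
open import Data.Rational.Unnormalised.Properties using (≤-respˡ-≃; ≃-sym) renaming (drop-*≤* to drop-*≤*ᵘ)
open import Data.Sum using (_⊎_; [_,_]′)
open import Data.Vec using ([]; _∷_; tabulate; lookup)
open import Data.Vec.Properties using (lookup∘tabulate)
open import Function using (flip; _⇔_; mk⇔; Equivalence)
open import Function.Properties.Equivalence using () renaming (trans to ⇔-trans)
open import Relation.Binary.PropositionalEquality using (_≡_; refl; sym; trans; subst; subst₂)

-- num r / den r is r only for 0 ≤ r, which every lemma using them assumes.
num : ℚ → ℕ
num r = ℤ.∣ ↥ r ∣

den : ℚ → ℕ
den r = ↧ₙ r

+num≡↥ : ∀ {r} → 0ℚ ≤ r → + num r ≡ ↥ r
+num≡↥ {r} 0≤r = ℤP.0≤i⇒+∣i∣≡i (subst (ℤ._≤_ (+ 0)) (ℤP.*-identityʳ (↥ r)) (drop-*≤* 0≤r))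

ℤ-ineq⇔ℕ-ineq : ∀ k d {r} → 0ℚ ≤ r →
  (+ k ℤ.* ↧ r ℤ.≤ ↥ r ℤ.* + d) ⇔ (k ℕ.* den r ℕ.≤ num r ℕ.* d)
ℤ-ineq⇔ℕ-ineq k d {r} 0≤r rewrite sym (+num≡↥ 0≤r) = mk⇔
  (λ ineq → ℤP.drop‿+≤+ (subst₂ ℤ._≤_ (sym (ℤP.pos-* k (den r))) (sym (ℤP.pos-* (num r) d)) ineq))
  (λ ineq → subst₂ ℤ._≤_ (ℤP.pos-* k (den r)) (ℤP.pos-* (num r) d) (+≤+ ineq))

/≤⇔ℤ-ineq : ∀ k d {r} → (+ k / suc d ≤ r) ⇔ (+ k ℤ.* ↧ r ℤ.≤ ↥ r ℤ.* + suc d)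
/≤⇔ℤ-ineq k d {r@record{}} = mk⇔
  (λ k/d≤r → drop-*≤*ᵘ (≤-respˡ-≃ k/d≃ (toℚᵘ-mono-≤ k/d≤r)))
  (λ ineq → toℚᵘ-cancel-≤ (≤-respˡ-≃ (≃-sym k/d≃) (*≤* ineq)))
  where
  k/d≃ : toℚᵘ (+ k / suc d) ≃ᵘ mkℚᵘ (+ k) d
  k/d≃ = toℚᵘ-fromℚᵘ (mkℚᵘ (+ k) d)

ratio≤⇔ : ∀ K U {r} → 0ℚ ≤ r →
  ratio K U ≤ r ⇔ (∣ U ∣ ℕ.* den r ℕ.≤ num r ℕ.* (∣ U ∣ ℕ.+ ∣ nbhd K U ∣))
ratio≤⇔ K U 0≤r with ∣ U ∣ ℕ.+ ∣ nbhd K U ∣ in size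
... | zero  rewrite m+n≡0⇒m≡0 ∣ U ∣ size = mk⇔ (λ _ → ℕ.z≤n) (λ _ → 0≤r)
... | suc d = ⇔-trans (/≤⇔ℤ-ineq ∣ U ∣ d) (ℤ-ineq⇔ℕ-ineq ∣ U ∣ (suc d) 0≤r)

Candidate : (K : Graph) → Subset (n K) → Set
Candidate K U = nonempty U ∧ independent K U ≡ true

private
  step : (K : Graph) → Subset (n K) → ℚ → ℚ
  step K U acc = if nonempty U ∧ independent K U then ratio K U ⊔ acc else acc

  ≤-step : ∀ K U acc → acc ≤ step K U acc
  ≤-step K U acc with nonempty U ∧ independent K U
  ... | true  = p≤q⊔p (ratio K U) acc
  ... | false = ≤-refl

∈-allSubsets : ∀ k (U : Subset k) → U ∈ allSubsets k
∈-allSubsets zero    []          = here refl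
∈-allSubsets (suc k) (true ∷ U)  = ∈-++⁺ˡ (∈-map⁺ (true ∷_) (∈-allSubsets k U))
∈-allSubsets (suc k) (false ∷ U) =
  ∈-++⁺ʳ (map (true ∷_) (allSubsets k)) (∈-map⁺ (false ∷_) (∈-allSubsets k U))

ratio≤a : ∀ K U → Candidate K U → ratio K U ≤ a K
ratio≤a K U U-candidate = go (allSubsets (n K)) (∈-allSubsets (n K) U)
  where
  go : ∀ Us → U ∈ Us → ratio K U ≤ foldr (step K) 0ℚ Us
  go (U ∷ Us) (here refl) with nonempty U ∧ independent K U
  go (U ∷ Us) (here refl) | true = p≤p⊔q (ratio K U) _
  go (V ∷ Us) (there U∈Us) = ≤-trans (go Us U∈Us) (≤-step K V _)

a≤ : ∀ K {r} → 0ℚ ≤ r → (∀ U → Candidate K U → ratio K U ≤ r) → a K ≤ r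
a≤ K {r} 0≤r ratio≤r = go (allSubsets (n K))
  where
  go : ∀ Us → foldr (step K) 0ℚ Us ≤ r
  go []       = 0≤r
  go (V ∷ Us) with nonempty V ∧ independent K V in V-candidate
  ... | true  = ⊔-lub (ratio≤r V V-candidate) (go Us)
  ... | false = go Us

0≤a : ∀ K → 0ℚ ≤ a K
0≤a K = go (allSubsets (n K))
  where
  go : ∀ Us → 0ℚ ≤ foldr (step K) 0ℚ Us
  go []       = ≤-refl
  go (V ∷ Us) = ≤-trans (go Us) (≤-step K V _)

a≤⇒ratioBounded : ∀ K {r} → 0ℚ ≤ r → a K ≤ r → RatioBounded (num r) (den r) K
a≤⇒ratioBounded K {r} 0≤r a≤r p p-indep =
  subst₂ (λ c m → c ℕ.* den r ℕ.≤ num r ℕ.* (c ℕ.+ m)) (∣tabulate∣ p) (∣nbhd-tabulate∣ K p) U-bound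
  where
  U : Subset (n K)
  U = tabulate p
  U-indep : independent K U ≡ true
  U-indep = Equivalence.from (independent⇔Independent K U)
    (Independent-⊆ K (λ u → trans (sym (lookup∘tabulate p u))) p-indep)
  U-bound : ∣ U ∣ ℕ.* den r ℕ.≤ num r ℕ.* (∣ U ∣ ℕ.+ ∣ nbhd K U ∣)
  U-bound with nonempty U in U-nonempty
  ... | true  = Equivalence.to (ratio≤⇔ K U 0≤r) (≤-trans (ratio≤a K U (∧-intro U-nonempty U-indep)) a≤r)
  ... | false rewrite trans (∣∣≡count-lookup U) (anyFin≡false⇒count≡0 (lookup U) U-nonempty) = ℕ.z≤n

ratio-×ᴳ≤ : ∀ G H {r} → 0ℚ ≤ r → (∀ R → ProductIndependent G H R → ProductBound G H (num r) (den r) R) →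
  ∀ I → Candidate (G ×ᴳ H) I → ratio (G ×ᴳ H) I ≤ r
ratio-×ᴳ≤ G H {r} 0≤r bound I I-candidate = Equivalence.from (ratio≤⇔ (G ×ᴳ H) I 0≤r)
  (subst₂ (λ s t → s ℕ.* den r ℕ.≤ num r ℕ.* (s ℕ.+ t))
    (sym (∣∣≡∑-count-toRelation G H I)) (sym (∣nbhd-×ᴳ∣≡∑-count-productN G H I))
    (bound (toRelation G H I) (independent⇒productIndependent G H I (∧-conicalʳ _ _ I-candidate))))

theorem3p2 : (G H : Graph) → n G ≥ 1 → n H ≥ 1 →
    (a G ≤ ½) ⊎ (a H ≤ ½) →
    a (G ×ᴳ H) ≤ (a G ⊔ a H)
theorem3p2 G H _ _ G-or-H-½ = a≤ (G ×ᴳ H) 0≤r (ratio-×ᴳ≤ G H 0≤r bound)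
  where
  r : ℚ
  r = a G ⊔ a H
  0≤r : 0ℚ ≤ r
  0≤r = ≤-trans (0≤a G) (p≤p⊔q (a G) (a H))
  G-bounded : RatioBounded (num r) (den r) G
  G-bounded = a≤⇒ratioBounded G 0≤r (p≤p⊔q (a G) (a H))
  H-bounded : RatioBounded (num r) (den r) H
  H-bounded = a≤⇒ratioBounded H 0≤r (p≤q⊔p (a G) (a H))
  bound : ∀ R → ProductIndependent G H R → ProductBound G H (num r) (den r) R
  bound R R-indep =
    [ (λ aG≤½ → productBound (num r) (den r) G H (a≤⇒ratioBounded G (nonNegative⁻¹ ½) aG≤½)
                             G-bounded H-bounded R R-indep)
    , (λ aH≤½ → productBound-swap (num r) (den r) G H R
         (productBound (num r) (den r) H G (a≤⇒ratioBounded H (nonNegative⁻¹ ½) aH≤½) H-bounded G-bounded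
                       (flip R) (productIndependent-swap G H R R-indep)))
    ]′ G-or-H-½
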